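{- Let $G:\mathbb{Z}_{>0}\to\mathbb{Z}_{>0}$ be defined by $$G(n)=\begin{cases}5n+1 & \text{if } n=h(n),\\ h(n) & \text{if } n>h(n),\end{cases}\qquad h(n)=2^{v_2(n)}\,3^{v_3(n)}.$$ Then no trajectory of $G$ diverges: for every positive integer $n$, the sequence $n, G(n), G(G(n)),\dots$ eventually enters a cycle (i.e. is eventually periodic).
   Context: $v_p(n)$ denotes the exponent of the prime $p$ in the factorization of $n$; $h(n)$ is the largest divisor of $n$ whose only prime factors are $2$ and $3$. -}

module Defs where

open import Data.Nat using (ℕ; zero; suc; _+_; _*_; _^_; NonZero)
open import Data.Nat.DivMod using (_/_)
open import Data.Nat.Divisibility using (_∣?_)
open import Relation.Nullary using (yes; no)
open import Data.Nat.Properties using (_≟_)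

-- Computed by repeatedly dividing by p; the fuel argument (initially n)
-- is always sufficient when p ≥ 2 and n > 0, since p^v ≤ n.
vAux : (fuel p : ℕ) .{{_ : NonZero p}} → ℕ → ℕ
vAux zero p n = 0
vAux (suc f) p n with p ∣? n
... | yes _ = suc (vAux f p (n / p))
... | no _ = 0

v : (p : ℕ) .{{_ : NonZero p}} → ℕ → ℕ
v p n = vAux n p n

h : ℕ → ℕ
h n = 2 ^ v 2 n * 3 ^ v 3 n

-- G n = 5n+1 if n = h n, and h n otherwise (for n > 0, n ≠ h n means n > h n)
G : ℕ → ℕ
G n with n ≟ h n
... | yes _ = 5 * n + 1
... | no _ = h n

iter : (ℕ → ℕ) → ℕ → ℕ → ℕ
iter f zero x = x
iter f (suc k) x = f (iter f k x)

-- Every n > 0 reaches the 3-smooth number h n in at most one step, and 1 → 6 → 31 → 1 is a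
-- cycle, so it suffices that every 3-smooth X > 1 reaches a smaller 3-smooth number.
-- From such an X, G gives m = 5X + 1 = h(m) s with s coprime to 6. If s ≠ 1 then s ≥ 5,
-- so h(m) ≤ X, and h(m) ≠ X because X ∤ 5X + 1: hence G m = h m < X. If s = 1 then m is
-- 3-smooth and coprime to X, so X = 2^a or X = 3^b; for X ≥ 4 the number 5m + 1 = 25X + 6
-- is 2 or 3 times a number coprime to 6, and G maps it to 2 or 3. X = 2, 3 are checked by
-- computation.
module Submission where

open import Data.Nat
open import Data.Nat.Properties
open import Data.Nat.DivMod using (_/_; m*n/n≡m)
open import Data.Nat.Divisibility
open import Data.Nat.Primality using (Prime; prime[2]; prime?; prime⇒nonTrivial; euclidsLemma)
open import Data.Nat.Induction using (<-rec)
open import Data.Nat.Tactic.RingSolver using (solve-∀)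
open import Algebra.Properties.CommutativeSemigroup *-commutativeSemigroup using (xy∙z≈y∙xz)
open import Data.Product using (Σ; _×_; _,_; ∃-syntax)
open import Data.Sum using (inj₁; inj₂)
open import Relation.Nullary using (yes; no; contradiction)
open import Relation.Nullary.Decidable using (from-yes; from-no)
open import Relation.Binary.PropositionalEquality
open import Function using (_∘_)
open import Defs

prime[3] : Prime 3
prime[3] = from-yes (prime? 3)

∤-* : ∀ {p m n} → Prime p → p ∤ m → p ∤ n → p ∤ m * n
∤-* {m = m} {n} pp p∤m p∤n p∣mn with euclidsLemma m n pp p∣mn
... | inj₁ p∣m = p∤m p∣m
... | inj₂ p∣n = p∤n p∣n

∤-^ : ∀ {p m} → Prime p → p ∤ m → ∀ k → p ∤ m ^ k
∤-^ {p} pp p∤m zero p∣1 = nonTrivial⇒≢1 {p} {{prime⇒nonTrivial pp}} (∣1⇒≡1 p∣1)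
∤-^ pp p∤m (suc k) = ∤-* pp p∤m (∤-^ pp p∤m k)

∣∧∤⇒∤+ : ∀ {p m n} → p ∣ m → p ∤ n → p ∤ m + n
∣∧∤⇒∤+ p∣m p∤n p∣m+n = p∤n (∣m+n∣m⇒∣n p∣m+n p∣m)

∤∧∣⇒∤+ : ∀ {p m n} → p ∤ m → p ∣ n → p ∤ m + n
∤∧∣⇒∤+ {p} {m} {n} p∤m p∣n = ∣∧∤⇒∤+ p∣n p∤m ∘ subst (p ∣_) (+-comm m n)

n<m^n : ∀ {m} → 1 < m → ∀ n → n < m ^ n
n<m^n 1<m zero = z<s
n<m^n {m} 1<m (suc n) = ≤-<-trans (n<m^n 1<m n) m^n<m*m^n
  where
  instance _ = >-nonZero (<-trans z<s 1<m)
  m^n<m*m^n : m ^ n < m * m ^ n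
  m^n<m*m^n = subst (m ^ n <_) (*-comm (m ^ n) m) (m<m*n (m ^ n) m {{m^n≢0 m n}} 1<m)

p^[1+a]*s/p≡p^a*s : ∀ p .{{_ : NonZero p}} a s → p ^ suc a * s / p ≡ p ^ a * s
p^[1+a]*s/p≡p^a*s p a s = begin
  p * p ^ a * s / p   ≡⟨ cong (_/ p) (*-assoc p (p ^ a) s) ⟩
  p * (p ^ a * s) / p ≡⟨ cong (_/ p) (*-comm p (p ^ a * s)) ⟩
  p ^ a * s * p / p   ≡⟨ m*n/n≡m (p ^ a * s) p ⟩
  p ^ a * s           ∎
  where open ≡-Reasoning

vAux[p^a*s]≡a : ∀ fuel p .{{_ : NonZero p}} a {s} → a < fuel → p ∤ s → vAux fuel p (p ^ a * s) ≡ a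
vAux[p^a*s]≡a (suc fuel) p zero {s} _ p∤s with p ∣? 1 * s
... | yes p∣1*s = contradiction (subst (p ∣_) (*-identityˡ s) p∣1*s) p∤s
... | no _ = refl
vAux[p^a*s]≡a (suc fuel) p (suc a) {s} (s≤s a<fuel) p∤s with p ∣? p ^ suc a * s
... | no p∤ = contradiction (∣m⇒∣m*n s (m∣m*n (p ^ a))) p∤
... | yes _ = cong suc (trans (cong (vAux fuel p) (p^[1+a]*s/p≡p^a*s p a s)) (vAux[p^a*s]≡a fuel p a a<fuel p∤s))

∤⇒>0 : ∀ {p s} → p ∤ s → 0 < s
∤⇒>0 {p} {zero} p∤0 = contradiction (p ∣0) p∤0
∤⇒>0 {s = suc _} _ = z<s

v[p^a*s]≡a : ∀ p .{{_ : NonZero p}} → 1 < p → ∀ a {s} → p ∤ s → v p (p ^ a * s) ≡ a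
v[p^a*s]≡a p 1<p a {s} p∤s = vAux[p^a*s]≡a (p ^ a * s) p a a<p^a*s p∤s
  where
  a<p^a*s : a < p ^ a * s
  a<p^a*s = <-≤-trans (n<m^n 1<p a) (m≤m*n (p ^ a) s {{>-nonZero (∤⇒>0 p∤s)}})

record Factorisation (n : ℕ) : Set where
  constructor factorisation
  field
    a b r : ℕ
    n≡2^a*3^b*r : n ≡ 2 ^ a * 3 ^ b * r
    2∤r : 2 ∤ r
    3∤r : 3 ∤ r

h-factorisation : ∀ {n} (f : Factorisation n) → let open Factorisation f in h n ≡ 2 ^ a * 3 ^ b
h-factorisation (factorisation a b r refl 2∤r 3∤r) = cong₂ (λ i j → 2 ^ i * 3 ^ j) v₂ v₃
  where
  v₂ : v 2 (2 ^ a * 3 ^ b * r) ≡ a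
  v₂ = trans (cong (v 2) (*-assoc (2 ^ a) (3 ^ b) r))
             (v[p^a*s]≡a 2 (s≤s (s≤s z≤n)) a (∤-* prime[2] (∤-^ prime[2] (from-no (2 ∣? 3)) b) 2∤r))
  v₃ : v 3 (2 ^ a * 3 ^ b * r) ≡ b
  v₃ = trans (cong (v 3) (xy∙z≈y∙xz (2 ^ a) (3 ^ b) r))
             (v[p^a*s]≡a 3 (s≤s (s≤s z≤n)) b (∤-* prime[3] (∤-^ prime[3] (from-no (3 ∣? 2)) a) 3∤r))

factor-out : ∀ p → 1 < p → ∀ n → 0 < n → ∃[ a ] ∃[ s ] n ≡ p ^ a * s × p ∤ s
factor-out p 1<p = <-rec _ go
  where
  go : ∀ n → (∀ {q} → q < n → 0 < q → ∃[ a ] ∃[ s ] q ≡ p ^ a * s × p ∤ s) →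
       0 < n → ∃[ a ] ∃[ s ] n ≡ p ^ a * s × p ∤ s
  go n rec 0<n with p ∣? n
  ... | no p∤n = 0 , n , sym (*-identityˡ n) , p∤n
  ... | yes (divides zero n≡0) = contradiction n≡0 (>⇒≢ 0<n)
  ... | yes (divides q@(suc _) n≡q*p) with rec q<n z<s
    where
    q<n : q < n
    q<n = subst (q <_) (sym n≡q*p) (m<m*n q p 1<p)
  ...   | a , s , q≡p^a*s , p∤s = suc a , s , n≡p^[1+a]*s , p∤s
    where
    n≡p^[1+a]*s : n ≡ p ^ suc a * s
    n≡p^[1+a]*s = begin
      n             ≡⟨ n≡q*p ⟩
      q * p         ≡⟨ *-comm q p ⟩
      p * q         ≡⟨ cong (p *_) q≡p^a*s ⟩
      p * (p ^ a * s) ≡⟨ *-assoc p (p ^ a) s ⟨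
      p ^ suc a * s ∎
      where open ≡-Reasoning

factorise : ∀ n → 0 < n → Factorisation n
factorise n 0<n with factor-out 2 (s≤s (s≤s z≤n)) n 0<n
... | a , s , n≡2^a*s , 2∤s with factor-out 3 (s≤s (s≤s z≤n)) s (∤⇒>0 2∤s)
...   | b , r , s≡3^b*r , 3∤r =
  factorisation a b r (trans n≡2^a*s (trans (cong (2 ^ a *_) s≡3^b*r) (sym (*-assoc (2 ^ a) (3 ^ b) r))))
    (2∤s ∘ subst (2 ∣_) (sym s≡3^b*r) ∘ ∣n⇒∣m*n (3 ^ b)) 3∤r

Smooth : ℕ → Set
Smooth n = ∃[ a ] ∃[ b ] n ≡ 2 ^ a * 3 ^ b

smooth⇒>0 : ∀ {n} → Smooth n → 0 < n
smooth⇒>0 (a , b , refl) = *-mono-≤ (m^n>0 2 a) (m^n>0 3 b)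

G-fixed : ∀ {n} → n ≡ h n → G n ≡ 5 * n + 1
G-fixed {n} n≡hn with n ≟ h n
... | yes _ = refl
... | no n≢hn = contradiction n≡hn n≢hn

G-unfixed : ∀ {n} → n ≢ h n → G n ≡ h n
G-unfixed {n} n≢hn with n ≟ h n
... | yes n≡hn = contradiction n≡hn n≢hn
... | no _ = refl

G-smooth : ∀ {n} → Smooth n → G n ≡ 5 * n + 1
G-smooth {n} (a , b , n≡2^a*3^b) = G-fixed (trans n≡2^a*3^b (sym (h-factorisation f)))
  where
  f : Factorisation n
  f = factorisation a b 1 (trans n≡2^a*3^b (sym (*-identityʳ _))) (from-no (2 ∣? 1)) (from-no (3 ∣? 1))

G-rough : ∀ {n} (f : Factorisation n) → let open Factorisation f in r ≢ 1 → G n ≡ 2 ^ a * 3 ^ b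
G-rough {n} f@(factorisation a b r n≡2^a*3^b*r _ _) r≢1 =
  trans (G-unfixed n≢hn) (h-factorisation f)
  where
  instance _ = >-nonZero (smooth⇒>0 (a , b , refl))
  n≢hn : n ≢ h n
  n≢hn n≡hn = r≢1 (*-cancelˡ-≡ r 1 (2 ^ a * 3 ^ b) (begin
    2 ^ a * 3 ^ b * r   ≡⟨ n≡2^a*3^b*r ⟨
    n                   ≡⟨ n≡hn ⟩
    h n                 ≡⟨ h-factorisation f ⟩
    2 ^ a * 3 ^ b       ≡⟨ *-identityʳ _ ⟨
    2 ^ a * 3 ^ b * 1   ∎))
    where open ≡-Reasoning

infix 4 _↝_
_↝_ : ℕ → ℕ → Set
x ↝ y = ∃[ k ] iter G k x ≡ y

iter-+ : ∀ (f : ℕ → ℕ) k j x → iter f (k + j) x ≡ iter f j (iter f k x)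
iter-+ f k zero x = cong (λ i → iter f i x) (+-identityʳ k)
iter-+ f k (suc j) x rewrite +-suc k j = cong f (iter-+ f k j x)

↝-step : ∀ {x y} → G x ≡ y → x ↝ y
↝-step Gx≡y = 1 , Gx≡y

↝-trans : ∀ {x y z} → x ↝ y → y ↝ z → x ↝ z
↝-trans {x} (k , x↝y) (j , y↝z) = k + j , trans (iter-+ G k j x) (trans (cong (iter G j) x↝y) y↝z)

5≤rough : ∀ {s} → 2 ∤ s → 3 ∤ s → s ≢ 1 → 5 ≤ s
5≤rough {0} 2∤s _ _ = contradiction (2 ∣0) 2∤s
5≤rough {1} _ _ s≢1 = contradiction refl s≢1
5≤rough {2} 2∤s _ _ = contradiction ∣-refl 2∤s
5≤rough {3} _ 3∤s _ = contradiction ∣-refl 3∤s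
5≤rough {4} 2∤s _ _ = contradiction (divides 2 refl) 2∤s
5≤rough {suc (suc (suc (suc (suc _))))} _ _ _ = s≤s (s≤s (s≤s (s≤s (s≤s z≤n))))

cofactor≥5⇒< : ∀ {X H s} → 1 < X → 5 * X + 1 ≡ H * s → 5 ≤ s → H < X
cofactor≥5⇒< {X} {H} {s} 1<X 5X+1≡Hs 5≤s = ≤∧≢⇒< H≤X H≢X
  where
  H≤X : H ≤ X
  H≤X = s≤s⁻¹ (*-cancelˡ-< 5 H (suc X) (begin-strict
    5 * H       ≤⟨ *-monoˡ-≤ H 5≤s ⟩
    s * H       ≡⟨ *-comm s H ⟩
    H * s       ≡⟨ 5X+1≡Hs ⟨
    5 * X + 1   <⟨ +-monoʳ-< (5 * X) (s≤s (s≤s z≤n)) ⟩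
    5 * X + 5   ≡⟨ +-comm (5 * X) 5 ⟩
    5 + 5 * X   ≡⟨ *-suc 5 X ⟨
    5 * suc X   ∎))
    where open ≤-Reasoning
  H≢X : H ≢ X
  H≢X refl = <⇒≢ 1<X (sym (∣1⇒≡1 (∣m+n∣m⇒∣n (divides s (trans 5X+1≡Hs (*-comm H s))) (n∣m*n 5))))

Descends : ℕ → Set
Descends X = ∃[ H ] Smooth H × H < X × X ↝ H

descends-via-5X+1 : ∀ {X} → Smooth X → 1 < X →
  (∃[ H ] Smooth H × H < X × G (5 * (5 * X + 1) + 1) ≡ H) → Descends X
descends-via-5X+1 {X} sX 1<X (H , sH , H<X , G[5m+1]≡H)
  with factorise (5 * X + 1) (m≤n+m 1 (5 * X))
... | f@(factorisation c d s m≡2^c*3^d*s 2∤s 3∤s) with s ≟ 1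
...   | yes refl = H , sH , H<X ,
  ↝-trans (↝-step (G-smooth sX)) (↝-trans (↝-step (G-smooth sm)) (↝-step G[5m+1]≡H))
  where
  sm : Smooth (5 * X + 1)
  sm = c , d , trans m≡2^c*3^d*s (*-identityʳ _)
...   | no s≢1 = 2 ^ c * 3 ^ d , (c , d , refl) ,
  cofactor≥5⇒< 1<X m≡2^c*3^d*s (5≤rough 2∤s 3∤s s≢1) ,
  ↝-trans (↝-step (G-smooth sX)) (↝-step (G-rough f s≢1))

5[5·2z+1]+1≡2[25z+3] : ∀ z → 5 * (5 * (2 * z) + 1) + 1 ≡ 2 * (25 * z + 3)
5[5·2z+1]+1≡2[25z+3] = solve-∀

5[5·3z+1]+1≡3[25z+2] : ∀ z → 5 * (5 * (3 * z) + 1) + 1 ≡ 3 * (25 * z + 2)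
5[5·3z+1]+1≡3[25z+2] = solve-∀

descent : ∀ a b → 1 < 2 ^ a * 3 ^ b → Descends (2 ^ a * 3 ^ b)
descent 0 0 (s≤s ())
-- 2 → 11 → 1 and 3 → 16 → 81 → 406 → 2
descent 1 0 _ = 1 , (0 , 0 , refl) , s≤s (s≤s z≤n) , 2 , refl
descent 0 1 _ = 2 , (1 , 0 , refl) , s≤s (s≤s (s≤s z≤n)) , 4 , refl
descent (suc a) (suc b) 1<X = 1 , (0 , 0 , refl) , 1<X ,
  ↝-trans (↝-step (G-smooth (suc a , suc b , refl))) (↝-step (G-rough f m≢1))
  where
  X = 2 ^ suc a * 3 ^ suc b
  f : Factorisation (5 * X + 1)
  f = factorisation 0 0 (5 * X + 1) (sym (*-identityˡ (5 * X + 1)))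
        (∣∧∤⇒∤+ (∣n⇒∣m*n 5 (∣m⇒∣m*n (3 ^ suc b) (m∣m*n (2 ^ a)))) (from-no (2 ∣? 1)))
        (∣∧∤⇒∤+ (∣n⇒∣m*n 5 (∣n⇒∣m*n (2 ^ suc a) (m∣m*n (3 ^ b)))) (from-no (3 ∣? 1)))
  m≢1 : 5 * X + 1 ≢ 1
  m≢1 = >⇒≢ (≤-trans 1<X (≤-trans (m≤n*m X 5) (m≤m+n (5 * X) 1)))
descent (suc (suc a)) 0 1<X = descends-via-5X+1 (suc (suc a) , 0 , refl) 1<X
  (2 , (1 , 0 , refl) , 2<X , G-rough y-factorisation t≢1)
  where
  z = 2 ^ suc a
  t = 25 * z + 3
  2<X : 2 < 2 ^ suc (suc a) * 3 ^ 0
  2<X = subst (2 <_) (sym (*-identityʳ _)) (^-monoʳ-< 2 (s≤s (s≤s z≤n)) {1} {2 + a} (s≤s (s≤s z≤n)))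
  y-factorisation : Factorisation (5 * (5 * (2 ^ suc (suc a) * 3 ^ 0) + 1) + 1)
  y-factorisation = factorisation 1 0 t
    (trans (cong (λ X → 5 * (5 * X + 1) + 1) (*-identityʳ (2 * z))) (5[5·2z+1]+1≡2[25z+3] z))
    (∣∧∤⇒∤+ (∣n⇒∣m*n 25 (m∣m*n (2 ^ a))) (from-no (2 ∣? 3)))
    (∤∧∣⇒∤+ (∤-* prime[3] (from-no (3 ∣? 25)) (∤-^ prime[3] (from-no (3 ∣? 2)) (suc a))) ∣-refl)
  t≢1 : t ≢ 1
  t≢1 t≡1 = contradiction (trans (+-comm 3 (25 * z)) t≡1) λ ()
descent 0 (suc (suc b)) 1<X = descends-via-5X+1 (0 , suc (suc b) , refl) 1<X
  (3 , (0 , 1 , refl) , 3<X , G-rough y-factorisation t≢1)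
  where
  z = 3 ^ suc b
  t = 25 * z + 2
  3<X : 3 < 2 ^ 0 * 3 ^ suc (suc b)
  3<X = subst (3 <_) (sym (*-identityˡ _)) (^-monoʳ-< 3 (s≤s (s≤s z≤n)) {1} {2 + b} (s≤s (s≤s z≤n)))
  y-factorisation : Factorisation (5 * (5 * (2 ^ 0 * 3 ^ suc (suc b)) + 1) + 1)
  y-factorisation = factorisation 0 1 t
    (trans (cong (λ X → 5 * (5 * X + 1) + 1) (*-identityˡ (3 * z))) (5[5·3z+1]+1≡3[25z+2] z))
    (∤∧∣⇒∤+ (∤-* prime[2] (from-no (2 ∣? 25)) (∤-^ prime[2] (from-no (2 ∣? 3)) (suc b))) ∣-refl)
    (∣∧∤⇒∤+ (∣n⇒∣m*n 25 (m∣m*n (3 ^ b))) (from-no (3 ∣? 2)))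
  t≢1 : t ≢ 1
  t≢1 t≡1 = contradiction (trans (+-comm 2 (25 * z)) t≡1) λ ()

smooth↝1 : ∀ X → Smooth X → X ↝ 1
smooth↝1 = <-rec _ go
  where
  go : ∀ X → (∀ {H} → H < X → Smooth H → H ↝ 1) → Smooth X → X ↝ 1
  go X rec sX@(a , b , refl) with 1 <? X
  ... | yes 1<X = let H , sH , H<X , X↝H = descent a b 1<X in ↝-trans X↝H (rec H<X sH)
  ... | no 1≮X = 0 , ≤-antisym (≮⇒≥ 1≮X) (smooth⇒>0 sX)

↝smooth : ∀ n → 0 < n → ∃[ H ] Smooth H × n ↝ H
↝smooth n 0<n with factorise n 0<n
... | f@(factorisation a b r n≡2^a*3^b*r _ _) with r ≟ 1
...   | yes refl = n , (a , b , trans n≡2^a*3^b*r (*-identityʳ _)) , 0 , refl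
...   | no r≢1 = 2 ^ a * 3 ^ b , (a , b , refl) , ↝-step (G-rough f r≢1)

iter-periodic-from : ∀ (f : ℕ → ℕ) k p x → iter f p (iter f k x) ≡ iter f k x → iter f (k + p) x ≡ iter f k x
iter-periodic-from f k p x cycle = trans (iter-+ f k p x) cycle

1-cycle : ∀ {x} → x ≡ 1 → iter G 3 x ≡ x
1-cycle refl = refl

theorem4p3 : (n : ℕ) → 0 < n →
    Σ ℕ (λ m → Σ ℕ (λ p → 0 < p × iter G (m + p) n ≡ iter G m n))
theorem4p3 n 0<n with ↝smooth n 0<n
... | H , sH , n↝H with ↝-trans n↝H (smooth↝1 H sH)
...   | k , Gᵏn≡1 = k , 3 , z<s , iter-periodic-from G k 3 n (1-cycle Gᵏn≡1)
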